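{- For any integers $1<m<n$, the sequence $B(m,n)$ is a permutation of $\{1,\dots,n\}$ (in particular it has length $n$).
   Context: For an integer $N\ge1$, $L(N)$ is the decreasing sequence of the elements of $\{1,\dots,N\}\setminus\{\lceil N/2\rceil\}$, of length $N-1$. For a sequence $\sigma$, $I(\sigma)$ is obtained by adding $1$ to every entry, and $I^k$ is the $k$-fold iterate ($I^0$ the identity). $\oplus$ denotes concatenation of sequences. For integers $1<m<n$, $B(m,n)=(2,3,\dots,m-1)\oplus(\lfloor (n+m)/2\rfloor)\oplus I^{m-1}(L(n-m+1))\oplus(1)$, where $(2,\dots,m-1)$ is empty if $m=2$. -}

module Defs where

open import Data.Nat using (ℕ; zero; suc; _+_; _∸_; _/_; _≟_)
open import Data.List using (List; []; _∷_; _++_; map; filter; downFrom; applyUpTo; [_])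
open import Relation.Nullary.Decidable using (¬?)

ceilHalf : ℕ → ℕ
ceilHalf N = (N + 1) / 2

decreasing : ℕ → List ℕ
decreasing N = map suc (downFrom N)

L : ℕ → List ℕ
L N = filter (λ k → ¬? (k ≟ ceilHalf N)) (decreasing N)

I : List ℕ → List ℕ
I = map suc

Iter : ℕ → List ℕ → List ℕ
Iter zero σ = σ
Iter (suc k) σ = I (Iter k σ)

-- (2, 3, ..., m-1)  (empty when m ≤ 2)
twoTo : ℕ → List ℕ
twoTo m = applyUpTo (λ i → i + 2) (m ∸ 2)

B : ℕ → ℕ → List ℕ
B m n = twoTo m ++ [ (n + m) / 2 ] ++ Iter (m ∸ 1) (L (n ∸ m + 1)) ++ [ 1 ]

oneTo : ℕ → List ℕ
oneTo n = applyUpTo suc n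

-- Write m = j + 1 and n = j + K. The block I^j(L(K)) consists of the values j + k for
-- 1 ≤ k ≤ K except k = ⌈K/2⌉, and the middle entry ⌊(n+m)/2⌋ is exactly the missing
-- value j + ⌈K/2⌉. So B(m,n) is, up to order, 2, …, j followed by j+1, …, j+K and then 1.
module Submission where

open import Defs
open import Data.Nat using (ℕ; _<_)
open import Data.List using (length)
open import Data.Product using (_×_)
open import Relation.Binary.PropositionalEquality using (_≡_)
open import Data.List.Relation.Binary.Permutation.Propositional using (_↭_)

open import Function using (_∘_)
open import Data.Nat using (zero; suc; _+_; _*_; _∸_; _/_; _≟_; _≤_; s≤s; z≤n)
open import Data.Nat.Properties
  using (<-irrefl; <-trans; n<1+n; ≤-pred; ≤∧≢⇒<; +-comm; +-suc; m+n∸m≡n; <⇒≤; m≤n⇒∃[o]m+o≡n)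
open import Data.Nat.DivMod using (m/n≡1+[m∸n]/n; m/n≤m; +-distrib-/-∣ʳ; m*n/n≡m)
open import Data.Nat.Divisibility using (n∣m*n)
open import Data.Nat.Tactic.RingSolver using (solve)
open import Data.List using (List; []; _∷_; _++_; map; filter; applyUpTo; applyDownFrom; [_])
open import Data.List.Properties
  using (filter-accept; filter-reject; map-id; map-∘; map-applyUpTo; map-downFrom; applyUpTo-∷ʳ; length-applyUpTo)
open import Data.List.Relation.Binary.Permutation.Propositional
  using (↭-refl; ↭-sym; ↭-trans; ↭-reflexive; prep; swap; module PermutationReasoning)
open import Data.List.Relation.Binary.Permutation.Propositional.Properties
  using (map⁺; ∷↭∷ʳ; ++⁺ˡ; ++⁺ʳ; shift; ↭-length)
open import Data.Product using (_,_)
open import Relation.Nullary using (yes; no)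
open import Relation.Nullary.Decidable using (¬?)
open import Relation.Binary.PropositionalEquality using (refl; sym; trans; cong; cong₂; _≗_; module ≡-Reasoning)

without : ℕ → List ℕ → List ℕ
without c = filter (λ k → ¬? (k ≟ c))

without-decreasing-< : ∀ {c} K → K < c → without c (decreasing K) ≡ decreasing K
without-decreasing-< zero    _   = refl
without-decreasing-< {c} (suc K) K<c =
  trans (filter-accept (λ k → ¬? (k ≟ c)) (λ K≡c → <-irrefl K≡c K<c))
        (cong (suc K ∷_) (without-decreasing-< K (<-trans (n<1+n K) K<c)))

decreasing-↭-∷-without : ∀ {c} K → 1 ≤ c → c ≤ K → decreasing K ↭ c ∷ without c (decreasing K)
decreasing-↭-∷-without zero (s≤s z≤n) ()
decreasing-↭-∷-without {c} (suc K) 1≤c c≤1+K with suc K ≟ c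
... | yes refl = prep (suc K) (↭-reflexive (sym (trans
       (filter-reject (λ k → ¬? (k ≟ suc K)) (λ K≢K → K≢K refl))
       (without-decreasing-< K (n<1+n K)))))
... | no 1+K≢c = ↭-trans (prep (suc K) (decreasing-↭-∷-without K 1≤c c≤K))
                 (↭-trans (swap (suc K) c ↭-refl)
                 (prep c (↭-reflexive (sym (filter-accept (λ k → ¬? (k ≟ c)) 1+K≢c)))))
  where
  c≤K : c ≤ K
  c≤K = ≤-pred (≤∧≢⇒< c≤1+K (1+K≢c ∘ sym))

applyDownFrom-↭-applyUpTo : ∀ (f : ℕ → ℕ) n → applyDownFrom f n ↭ applyUpTo f n
applyDownFrom-↭-applyUpTo f zero    = ↭-refl
applyDownFrom-↭-applyUpTo f (suc n) =
  ↭-trans (prep (f n) (applyDownFrom-↭-applyUpTo f n))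
  (↭-trans (∷↭∷ʳ (f n) (applyUpTo f n)) (↭-reflexive (applyUpTo-∷ʳ f n)))

decreasing-↭-oneTo : ∀ K → decreasing K ↭ oneTo K
decreasing-↭-oneTo K =
  ↭-trans (↭-reflexive (map-downFrom suc K)) (applyDownFrom-↭-applyUpTo suc K)

ceilHalf-suc : ∀ K → ceilHalf (suc K) ≡ suc (K / 2)
ceilHalf-suc K = trans (cong (_/ 2) (+-comm (suc K) 1)) (m/n≡1+[m∸n]/n {2 + K} (s≤s (s≤s z≤n)))

ceilHalf-∷-L-↭-oneTo : ∀ K → ceilHalf (suc K) ∷ L (suc K) ↭ oneTo (suc K)
ceilHalf-∷-L-↭-oneTo K =
  ↭-trans (↭-sym (decreasing-↭-∷-without (suc K) 1≤c c≤1+K)) (decreasing-↭-oneTo (suc K))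
  where
  1≤c : 1 ≤ ceilHalf (suc K)
  1≤c rewrite ceilHalf-suc K = s≤s z≤n
  c≤1+K : ceilHalf (suc K) ≤ suc K
  c≤1+K rewrite ceilHalf-suc K = s≤s (m/n≤m K 2)

Iter≡map : ∀ j σ → Iter j σ ≡ map (j +_) σ
Iter≡map zero    σ = sym (map-id σ)
Iter≡map (suc j) σ = trans (cong I (Iter≡map j σ)) (sym (map-∘ σ))

applyUpTo-cong : ∀ {f g : ℕ → ℕ} → f ≗ g → applyUpTo f ≗ applyUpTo g
applyUpTo-cong f≗g zero    = refl
applyUpTo-cong f≗g (suc n) = cong₂ _∷_ (f≗g 0) (applyUpTo-cong (f≗g ∘ suc) n)

applyUpTo-+ : ∀ (f : ℕ → ℕ) p q → applyUpTo f (p + q) ≡ applyUpTo f p ++ applyUpTo (f ∘ (p +_)) q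
applyUpTo-+ f zero    q = refl
applyUpTo-+ f (suc p) q = cong (f 0 ∷_) (applyUpTo-+ (f ∘ suc) p q)

oneTo-+ : ∀ p q → oneTo (p + q) ≡ oneTo p ++ map (p +_) (oneTo q)
oneTo-+ p q = begin
  oneTo (p + q)                                   ≡⟨ applyUpTo-+ suc p q ⟩
  oneTo p ++ applyUpTo (λ i → suc (p + i)) q      ≡⟨ cong (oneTo p ++_) (applyUpTo-cong (sym ∘ +-suc p) q) ⟩
  oneTo p ++ applyUpTo (λ i → p + suc i) q        ≡⟨ cong (oneTo p ++_) (map-applyUpTo suc (p +_) q) ⟨
  oneTo p ++ map (p +_) (oneTo q)                 ∎
  where open ≡-Reasoning

oneTo-suc≡1∷twoTo : ∀ a → oneTo (suc a) ≡ 1 ∷ twoTo (suc (suc a))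
oneTo-suc≡1∷twoTo a = cong (1 ∷_) (applyUpTo-cong (λ i → +-comm 2 i) a)

middle-entry : ∀ j d → (suc j + d + suc j) / 2 ≡ j + ceilHalf (suc d)
middle-entry j d = begin
  (suc j + d + suc j) / 2           ≡⟨ cong (_/ 2) regroup ⟩
  (suc d + 1 + j * 2) / 2           ≡⟨ +-distrib-/-∣ʳ (suc d + 1) (n∣m*n j {2}) ⟩
  ceilHalf (suc d) + j * 2 / 2      ≡⟨ cong (ceilHalf (suc d) +_) (m*n/n≡m j 2) ⟩
  ceilHalf (suc d) + j              ≡⟨ +-comm (ceilHalf (suc d)) j ⟩
  j + ceilHalf (suc d)              ∎
  where
  open ≡-Reasoning
  regroup : suc j + d + suc j ≡ suc d + 1 + j * 2
  regroup = solve (j ∷ d ∷ [])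

B-↭-oneTo : ∀ m d → 2 ≤ m → B m (m + d) ↭ oneTo (m + d)
B-↭-oneTo m@(suc (suc a)) d (s≤s (s≤s z≤n)) = begin
  T ++ [ (m + d + m) / 2 ] ++ Iter j (L (m + d ∸ m + 1)) ++ [ 1 ]
    ≡⟨ cong (λ xs → T ++ xs ++ [ 1 ]) middle-and-block ⟩
  T ++ map (j +_) (ceilHalf K ∷ L K) ++ [ 1 ]
    ↭⟨ ++⁺ˡ T (++⁺ʳ [ 1 ] (map⁺ (j +_) (ceilHalf-∷-L-↭-oneTo d))) ⟩
  T ++ map (j +_) (oneTo K) ++ [ 1 ]
    ↭⟨ ++⁺ˡ T (∷↭∷ʳ 1 (map (j +_) (oneTo K))) ⟨
  T ++ [ 1 ] ++ map (j +_) (oneTo K)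
    ↭⟨ shift 1 T (map (j +_) (oneTo K)) ⟩
  1 ∷ T ++ map (j +_) (oneTo K)
    ≡⟨ cong (_++ map (j +_) (oneTo K)) (oneTo-suc≡1∷twoTo a) ⟨
  oneTo j ++ map (j +_) (oneTo K)
    ≡⟨ oneTo-+ j K ⟨
  oneTo (j + K)
    ≡⟨ cong oneTo (+-suc j d) ⟩
  oneTo (m + d) ∎
  where
  open PermutationReasoning
  T = twoTo m
  j = suc a
  K = suc d
  middle-and-block : [ (m + d + m) / 2 ] ++ Iter j (L (m + d ∸ m + 1)) ≡ map (j +_) (ceilHalf K ∷ L K)
  middle-and-block = cong₂ _∷_ (middle-entry j d)
    (trans (cong (Iter j ∘ L) (trans (cong (_+ 1) (m+n∸m≡n m d)) (+-comm d 1))) (Iter≡map j (L K)))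

lemma3p6 : (m n : ℕ) → 1 < m → m < n → (B m n ↭ oneTo n) × (length (B m n) ≡ n)
lemma3p6 m n 1<m m<n with m≤n⇒∃[o]m+o≡n (<⇒≤ m<n)
... | d , refl = B↭oneTo , trans (↭-length B↭oneTo) (length-applyUpTo suc (m + d))
  where
  B↭oneTo : B m (m + d) ↭ oneTo (m + d)
  B↭oneTo = B-↭-oneTo m d 1<m
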